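{- Let $k\ge 1$ be an integer. If a $(2k+1)$-graph is $\mathscr{G}_{2k+1}(4k+2,3)$-free, then it is $2$-cancellative.
   Context: An $r$-graph is a family of distinct $r$-element subsets (edges) of a finite vertex set. For integers $v,e$, an $r$-graph is $\mathscr{G}_r(v,e)$-free if the union of any $e$ distinct edges contains at least $v+1$ vertices. An $r$-graph $\mathcal{H}$ is $2$-cancellative if for any $4$ distinct edges $A_1,A_2,B,C\in\mathcal{H}$ one has $A_1\cup A_2\cup B\neq A_1\cup A_2\cup C$. -}

module Defs where

open import Data.Nat using (ℕ; suc; _≤_)
open import Data.Fin.Subset using (Subset; _∪_; ∣_∣)
open import Data.List using (List)
open import Data.List.Relation.Unary.All using (All)
open import Data.List.Relation.Unary.Unique.Propositional using (Unique)
open import Data.List.Membership.Propositional using (_∈_)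
open import Relation.Binary.PropositionalEquality using (_≡_; _≢_)

record IsRGraph (r n : ℕ) (H : List (Subset n)) : Set where
  field
    uniform  : All (λ E → ∣ E ∣ ≡ r) H
    distinct : Unique H

G3Free : ∀ {n} (v : ℕ) (H : List (Subset n)) → Set
G3Free v H = ∀ {A B C} → A ∈ H → B ∈ H → C ∈ H →
  A ≢ B → A ≢ C → B ≢ C → suc v ≤ ∣ A ∪ (B ∪ C) ∣

TwoCancellative : ∀ {n} (H : List (Subset n)) → Set
TwoCancellative H = ∀ {A₁ A₂ B C} → A₁ ∈ H → A₂ ∈ H → B ∈ H → C ∈ H →
  A₁ ≢ A₂ → A₁ ≢ B → A₁ ≢ C → A₂ ≢ B → A₂ ≢ C → B ≢ C →
  (A₁ ∪ A₂) ∪ B ≢ (A₁ ∪ A₂) ∪ C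

module Submission where

-- Let A₁, A₂, B, C be distinct edges with A₁ ∪ A₂ ∪ B = A₁ ∪ A₂ ∪ C.
-- Then every vertex of B ∪ C lies in A₁ ∪ A₂ or in both B and C, and counting
-- vertex by vertex gives the overlap bound
--     ∣A₁ ∪ B ∪ C∣ + ∣A₂ ∪ B ∪ C∣ ≤ ∣A₁∣ + ∣A₂∣ + ∣B∣ + ∣C∣.
-- For an r-graph the right-hand side is 4r, while 𝒢_r(2r,3)-freeness applied to
-- the triples {A₁,B,C} and {A₂,B,C} makes the left-hand side at least 4r + 2.

open import Defs
open import Data.Nat using (ℕ; _≤_; _+_; _*_; _<_; suc; z≤n; s≤s)
open import Data.Nat.Properties using (+-mono-≤; <⇒≱; ≤-trans; n≤1+n; module ≤-Reasoning)
open import Data.Nat.Tactic.RingSolver using (solve-∀)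
open import Data.Bool using (Bool; true; false; _∨_)
open import Data.Vec using ([]; _∷_)
open import Data.Vec.Properties using (∷-injectiveˡ; ∷-injectiveʳ)
open import Data.Fin.Subset using (Subset; _∪_; ∣_∣)
open import Data.List using (List)
open import Data.List.Relation.Unary.All using (lookup)
open import Data.Empty using (⊥)
open import Relation.Binary.PropositionalEquality using (_≡_; refl; sym; cong₂; subst)

weight : Bool → ℕ
weight true  = 1
weight false = 0

∣x∷p∣ : ∀ {n} (x : Bool) (p : Subset n) → ∣ x ∷ p ∣ ≡ weight x + ∣ p ∣
∣x∷p∣ true  p = refl
∣x∷p∣ false p = refl

-- The overlap bound at a single vertex: if the vertex is in B or C, the
-- hypothesis puts it in A₁ ∪ A₂ or in both B and C, so the right side is ≥ 2.
vertex-overlap-bound : ∀ a₁ a₂ b c → (a₁ ∨ a₂) ∨ b ≡ (a₁ ∨ a₂) ∨ c →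
  weight (a₁ ∨ (b ∨ c)) + weight (a₂ ∨ (b ∨ c))
    ≤ ((weight a₁ + weight a₂) + weight b) + weight c
vertex-overlap-bound true  true  b     c     _ = s≤s (s≤s z≤n)
vertex-overlap-bound true  false true  c     _ = s≤s (s≤s z≤n)
vertex-overlap-bound true  false false true  _ = s≤s (s≤s z≤n)
vertex-overlap-bound true  false false false _ = s≤s z≤n
vertex-overlap-bound false true  true  c     _ = s≤s (s≤s z≤n)
vertex-overlap-bound false true  false true  _ = s≤s (s≤s z≤n)
vertex-overlap-bound false true  false false _ = s≤s z≤n
vertex-overlap-bound false false true  true  _ = s≤s (s≤s z≤n)
vertex-overlap-bound false false true  false ()
vertex-overlap-bound false false false true  ()
vertex-overlap-bound false false false false _ = z≤n

overlap-bound : ∀ {n} (A₁ A₂ B C : Subset n) → (A₁ ∪ A₂) ∪ B ≡ (A₁ ∪ A₂) ∪ C →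
  ∣ A₁ ∪ (B ∪ C) ∣ + ∣ A₂ ∪ (B ∪ C) ∣ ≤ ((∣ A₁ ∣ + ∣ A₂ ∣) + ∣ B ∣) + ∣ C ∣
overlap-bound [] [] [] [] _ = z≤n
overlap-bound (a₁ ∷ A₁) (a₂ ∷ A₂) (b ∷ B) (c ∷ C) eq = begin
  ∣ (a₁ ∨ (b ∨ c)) ∷ (A₁ ∪ (B ∪ C)) ∣ + ∣ (a₂ ∨ (b ∨ c)) ∷ (A₂ ∪ (B ∪ C)) ∣
    ≡⟨ cong₂ _+_ (∣x∷p∣ (a₁ ∨ (b ∨ c)) (A₁ ∪ (B ∪ C))) (∣x∷p∣ (a₂ ∨ (b ∨ c)) (A₂ ∪ (B ∪ C))) ⟩
  (weight (a₁ ∨ (b ∨ c)) + ∣ A₁ ∪ (B ∪ C) ∣) + (weight (a₂ ∨ (b ∨ c)) + ∣ A₂ ∪ (B ∪ C) ∣)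
    ≡⟨ interchange₂ (weight (a₁ ∨ (b ∨ c))) (weight (a₂ ∨ (b ∨ c)))
                   (∣ A₁ ∪ (B ∪ C) ∣) (∣ A₂ ∪ (B ∪ C) ∣) ⟩
  (weight (a₁ ∨ (b ∨ c)) + weight (a₂ ∨ (b ∨ c))) + (∣ A₁ ∪ (B ∪ C) ∣ + ∣ A₂ ∪ (B ∪ C) ∣)
    ≤⟨ +-mono-≤ (vertex-overlap-bound a₁ a₂ b c (∷-injectiveˡ eq))
                (overlap-bound A₁ A₂ B C (∷-injectiveʳ eq)) ⟩
  (((weight a₁ + weight a₂) + weight b) + weight c) + (((∣ A₁ ∣ + ∣ A₂ ∣) + ∣ B ∣) + ∣ C ∣)
    ≡⟨ interchange₄ (weight a₁) (weight a₂) (weight b) (weight c)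
                   (∣ A₁ ∣) (∣ A₂ ∣) (∣ B ∣) (∣ C ∣) ⟩
  (((weight a₁ + ∣ A₁ ∣) + (weight a₂ + ∣ A₂ ∣)) + (weight b + ∣ B ∣)) + (weight c + ∣ C ∣)
    ≡⟨ cong₂ _+_ (cong₂ _+_ (cong₂ _+_ (sym (∣x∷p∣ a₁ A₁)) (sym (∣x∷p∣ a₂ A₂)))
                            (sym (∣x∷p∣ b B))) (sym (∣x∷p∣ c C)) ⟩
  ((∣ a₁ ∷ A₁ ∣ + ∣ a₂ ∷ A₂ ∣) + ∣ b ∷ B ∣) + ∣ c ∷ C ∣ ∎
  where
  open ≤-Reasoning
  interchange₂ : ∀ a b x y → (a + x) + (b + y) ≡ (a + b) + (x + y)
  interchange₂ = solve-∀
  interchange₄ : ∀ a b c d x y z w →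
    (((a + b) + c) + d) + (((x + y) + z) + w) ≡ (((a + x) + (b + y)) + (c + z)) + (d + w)
  interchange₄ = solve-∀

no-room : ∀ r {x y} → suc (2 * r) ≤ x → suc (2 * r) ≤ y → x + y ≤ ((r + r) + r) + r → ⊥
no-room r {x} {y} x-large y-large sum-small = <⇒≱ four-r<x+y sum-small
  where
  four-r<x+y : ((r + r) + r) + r < x + y
  four-r<x+y = ≤-trans (n≤1+n _) (subst (_≤ x + y) (lower-sum r) (+-mono-≤ x-large y-large))
    where
    lower-sum : ∀ r → suc (2 * r) + suc (2 * r) ≡ suc (suc (((r + r) + r) + r))
    lower-sum = solve-∀

G3Free⇒TwoCancellative : ∀ r {n} (H : List (Subset n)) →
  IsRGraph r n H → G3Free (2 * r) H → TwoCancellative H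
G3Free⇒TwoCancellative r H graph free
  {A₁} {A₂} {B} {C} A₁∈H A₂∈H B∈H C∈H _ A₁≢B A₁≢C A₂≢B A₂≢C B≢C same-union =
  no-room r (free A₁∈H B∈H C∈H A₁≢B A₁≢C B≢C) (free A₂∈H B∈H C∈H A₂≢B A₂≢C B≢C)
    (subst (∣ A₁ ∪ (B ∪ C) ∣ + ∣ A₂ ∪ (B ∪ C) ∣ ≤_) edge-sizes
      (overlap-bound A₁ A₂ B C same-union))
  where
  open IsRGraph graph using (uniform)
  edge-sizes : ((∣ A₁ ∣ + ∣ A₂ ∣) + ∣ B ∣) + ∣ C ∣ ≡ ((r + r) + r) + r
  edge-sizes = cong₂ _+_ (cong₂ _+_ (cong₂ _+_ (lookup uniform A₁∈H) (lookup uniform A₂∈H))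
                                    (lookup uniform B∈H)) (lookup uniform C∈H)

lemma3 : (k : ℕ) → 1 ≤ k → (n : ℕ) → (H : List (Subset n)) →
    IsRGraph (2 * k + 1) n H → G3Free (4 * k + 2) H → TwoCancellative H
lemma3 k _ n H graph free =
  G3Free⇒TwoCancellative (2 * k + 1) H graph (subst (λ v → G3Free v H) (twice-edge-size k) free)
  where
  twice-edge-size : ∀ k → 4 * k + 2 ≡ 2 * (2 * k + 1)
  twice-edge-size = solve-∀
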